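{- Let $M$ be an SF-term that is strongly normalising with respect to $\rightarrow_{\mathrm{SF}}$. Then $[\![M]\!]_{@}$ is strongly normalising with respect to $\rightarrow_{\mathrm{SF}^{\mathcal{C}}_{@}}$.
   Context: SF-calculus: terms are given by $M, N ::= \mathbf{S} \mid \mathbf{F} \mid M\,N$ (application, left-associative; no variables). Terms of the form $\mathbf{S}$, $\mathbf{F}$, $\mathbf{S}\,M$, $\mathbf{F}\,M$, $\mathbf{S}\,M\,N$, $\mathbf{F}\,M\,N$ are called factorable forms. The one-step reduction $\rightarrow_{\mathrm{SF}}$ is the smallest relation closed under term contexts satisfying: $\mathbf{S}\,M\,N\,X \rightarrow_{\mathrm{SF}} M\,X\,(N\,X)$; $\mathbf{F}\,O\,M\,N \rightarrow_{\mathrm{SF}} M$ if $O$ is $\mathbf{S}$ or $\mathbf{F}$; $\mathbf{F}\,(P\,Q)\,M\,N \rightarrow_{\mathrm{SF}} N\,P\,Q$ if $P\,Q$ is a factorable form. A term is strongly normalising if it has no infinite reduction sequence. Curryfied applicative SF-calculus $\mathrm{SF}^{\mathcal{C}}_{@}$: the first-order term rewriting system over the signature with constructors $\mathbf{S}_0,\mathbf{F}_0$ (arity 0), $\mathbf{S}_1,\mathbf{F}_1$ (arity 1), $\mathbf{S}_2,\mathbf{F}_2$ (arity 2), and program symbols $\mathsf{app}$ (arity 2) and $\mathsf{fred}$ (arity 3), with rewrite rules $\mathsf{app}(\mathbf{S}_0,x)\to\mathbf{S}_1(x)$; $\mathsf{app}(\mathbf{S}_1(x),y)\to\mathbf{S}_2(x,y)$;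 $\mathsf{app}(\mathbf{S}_2(x,y),z)\to\mathsf{app}(\mathsf{app}(x,z),\mathsf{app}(y,z))$; $\mathsf{app}(\mathbf{F}_0,x)\to\mathbf{F}_1(x)$; $\mathsf{app}(\mathbf{F}_1(x),y)\to\mathbf{F}_2(x,y)$; $\mathsf{app}(\mathbf{F}_2(x,y),z)\to\mathsf{fred}(x,y,z)$; $\mathsf{fred}(\mathbf{S}_0,y,z)\to y$; $\mathsf{fred}(\mathbf{F}_0,y,z)\to y$; $\mathsf{fred}(\mathbf{S}_1(x),y,z)\to\mathsf{app}(\mathsf{app}(z,\mathbf{S}_0),x)$; $\mathsf{fred}(\mathbf{F}_1(x),y,z)\to\mathsf{app}(\mathsf{app}(z,\mathbf{F}_0),x)$; $\mathsf{fred}(\mathbf{S}_2(p,q),y,z)\to\mathsf{app}(\mathsf{app}(z,\mathsf{app}(\mathbf{S}_0,p)),q)$; $\mathsf{fred}(\mathbf{F}_2(p,q),y,z)\to\mathsf{app}(\mathsf{app}(z,\mathsf{app}(\mathbf{F}_0,p)),q)$. Its one-step reduction $\rightarrow_{\mathrm{SF}^{\mathcal{C}}_{@}}$ is the closure of these rules under substitution and contexts. The translation $[\![\cdot]\!]_{@}$: $[\![\mathbf{S}]\!]_{@}=\mathbf{S}_0$, $[\![\mathbf{F}]\!]_{@}=\mathbf{F}_0$, $[\![M\,N]\!]_{@}=\mathsf{app}([\![M]\!]_{@},[\![N]\!]_{@})$. -}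

module Defs where

open import Induction.WellFounded using (Acc)
open import Relation.Binary.Core using (Rel)
open import Level using (0ℓ)

Flip : {A : Set} → Rel A 0ℓ → Rel A 0ℓ
Flip R x y = R y x

SN : {A : Set} → Rel A 0ℓ → A → Set
SN R x = Acc (Flip R) x

infixl 9 _·_

data SF : Set where
  S F  : SF
  _·_  : SF → SF → SF

data Atom : SF → Set where
  atomS : Atom S
  atomF : Atom F

data Factorable : SF → Set where
  fS   : Factorable S
  fF   : Factorable F
  fS1  : ∀ M → Factorable (S · M)
  fF1  : ∀ M → Factorable (F · M)
  fS2  : ∀ M N → Factorable (S · M · N)
  fF2  : ∀ M N → Factorable (F · M · N)

infix 4 _→SF_

data _→SF_ : SF → SF → Set where
  sRule  : ∀ M N X → S · M · N · X →SF M · X · (N · X)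
  fAtom  : ∀ O M N → Atom O → F · O · M · N →SF M
  fComp  : ∀ P Q M N → Factorable (P · Q) → F · (P · Q) · M · N →SF N · P · Q
  appL   : ∀ {M M′} N → M →SF M′ → M · N →SF M′ · N
  appR   : ∀ M {N N′} → N →SF N′ → M · N →SF M · N′

-- Curryfied applicative SF-calculus (ground terms over the signature;
-- rules are closed under all (ground) substitutions via metavariables,
-- and under all contexts).

data T : Set where
  S₀ F₀ : T
  S₁ F₁ : T → T
  S₂ F₂ : T → T → T
  app   : T → T → T
  fred  : T → T → T → T

infix 4 _→C_

data _→C_ : T → T → Set where
  r-S0 : ∀ x → app S₀ x →C S₁ x
  r-S1 : ∀ x y → app (S₁ x) y →C S₂ x y
  r-S2 : ∀ x y z → app (S₂ x y) z →C app (app x z) (app y z)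
  r-F0 : ∀ x → app F₀ x →C F₁ x
  r-F1 : ∀ x y → app (F₁ x) y →C F₂ x y
  r-F2 : ∀ x y z → app (F₂ x y) z →C fred x y z
  r-fS0 : ∀ y z → fred S₀ y z →C y
  r-fF0 : ∀ y z → fred F₀ y z →C y
  r-fS1 : ∀ x y z → fred (S₁ x) y z →C app (app z S₀) x
  r-fF1 : ∀ x y z → fred (F₁ x) y z →C app (app z F₀) x
  r-fS2 : ∀ p q y z → fred (S₂ p q) y z →C app (app z (app S₀ p)) q
  r-fF2 : ∀ p q y z → fred (F₂ p q) y z →C app (app z (app F₀ p)) q
  c-S₁    : ∀ {x x′} → x →C x′ → S₁ x →C S₁ x′
  c-F₁    : ∀ {x x′} → x →C x′ → F₁ x →C F₁ x′
  c-S₂l   : ∀ {x x′} y → x →C x′ → S₂ x y →C S₂ x′ y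
  c-S₂r   : ∀ x {y y′} → y →C y′ → S₂ x y →C S₂ x y′
  c-F₂l   : ∀ {x x′} y → x →C x′ → F₂ x y →C F₂ x′ y
  c-F₂r   : ∀ x {y y′} → y →C y′ → F₂ x y →C F₂ x y′
  c-appl  : ∀ {x x′} y → x →C x′ → app x y →C app x′ y
  c-appr  : ∀ x {y y′} → y →C y′ → app x y →C app x y′
  c-fred1 : ∀ {x x′} y z → x →C x′ → fred x y z →C fred x′ y z
  c-fred2 : ∀ x {y y′} z → y →C y′ → fred x y z →C fred x y′ z
  c-fred3 : ∀ x y {z z′} → z →C z′ → fred x y z →C fred x y z′

⟦_⟧ₐ : SF → T
⟦ S ⟧ₐ = S₀
⟦ F ⟧ₐ = F₀
⟦ M · N ⟧ₐ = app ⟦ M ⟧ₐ ⟦ N ⟧ₐ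

module Submission where

-- Idea: read every curryfied term back as an SF-term (decode, which
-- forgets the arity annotation S₀/S₁/S₂, … and turns fred into F applied
-- to three arguments) and weigh it by its number of app nodes.  Every
-- step of the curryfied system is then either
--   * mapped by decode to one SF-step (the rules that really compute:
--     the S₂-rule and the fred-rules), or
--   * invisible after decoding but strictly decreasing the weight (the
--     rules that only record one more argument in a constructor).
-- A general fact about abstract rewriting (snReflect) says that such a
-- "projection with a measure" reflects strong normalisation: a
-- lexicographic induction on SN of the image and the measure.
-- The theorem follows because decoding is a left inverse of ⟦_⟧ₐ.

open import Defs
open import Level using (0ℓ)
open import Function using (id)
open import Data.Nat using (ℕ; suc; _+_; _<_; s≤s)
open import Data.Nat.Properties using (n<1+n; +-monoˡ-<; +-monoʳ-<)
open import Data.Nat.Induction using (<-wellFounded)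
open import Data.Product using (_×_; _,_)
open import Data.Sum using (_⊎_; inj₁; inj₂; [_,_]′)
open import Induction.WellFounded using (Acc; acc)
open import Relation.Binary.Core using (Rel)
open import Relation.Binary.PropositionalEquality using (_≡_; refl; sym; cong; cong₂; subst)

module Projection {A B : Set} (Q : Rel B 0ℓ) (f : A → B) (m : A → ℕ) where

  Covered : A → A → Set
  Covered a a′ = Q (f a) (f a′) ⊎ (f a′ ≡ f a × m a′ < m a)

  module _ (R : Rel A 0ℓ) (cover : ∀ {a a′} → R a a′ → Covered a a′) where

    -- Inner induction on the measure: if every Q-reduct of b has only SN
    -- preimages, then so does b, since the steps not reducing b lower m.
    snByMeasure : ∀ {b} → (∀ {b′} → Q b b′ → ∀ {a} → f a ≡ b′ → SN R a) →
                  ∀ {a} → f a ≡ b → Acc _<_ (m a) → SN R a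
    snByMeasure reducts-SN refl (acc smaller) = acc λ step →
      [ (λ q → reducts-SN q refl)
      , (λ { (eq , lt) → snByMeasure reducts-SN eq (smaller lt) })
      ]′ (cover step)

    snReflectAt : ∀ {b} → SN Q b → ∀ {a} → f a ≡ b → SN R a
    snReflectAt (acc snQ) eq =
      snByMeasure (λ q → snReflectAt (snQ q)) eq (<-wellFounded _)

    snReflect : ∀ a → SN Q (f a) → SN R a
    snReflect a sn = snReflectAt sn refl

decode : T → SF
decode S₀           = S
decode F₀           = F
decode (S₁ x)       = S · decode x
decode (F₁ x)       = F · decode x
decode (S₂ x y)     = S · decode x · decode y
decode (F₂ x y)     = F · decode x · decode y
decode (app x y)    = decode x · decode y
decode (fred x y z) = F · decode x · decode y · decode z

-- Number of app nodes; decreases along the steps invisible to decode.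
apps : T → ℕ
apps S₀           = 0
apps F₀           = 0
apps (S₁ x)       = apps x
apps (F₁ x)       = apps x
apps (S₂ x y)     = apps x + apps y
apps (F₂ x y)     = apps x + apps y
apps (app x y)    = suc (apps x + apps y)
apps (fred x y z) = apps x + apps y + apps z

decode-⟦⟧ : ∀ M → decode ⟦ M ⟧ₐ ≡ M
decode-⟦⟧ S       = refl
decode-⟦⟧ F       = refl
decode-⟦⟧ (M · N) = cong₂ _·_ (decode-⟦⟧ M) (decode-⟦⟧ N)

open Projection _→SF_ decode apps

-- The conclusion is stated in
-- unfolded form so that it matches Covered of any curryfied context
-- decoding to c and weighing w.
coveredInContext : (c : SF → SF) (w : ℕ → ℕ) →
                   (∀ {M N} → M →SF N → c M →SF c N) →
                   (∀ {m n} → m < n → w m < w n) →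
                   ∀ {t t′} → Covered t t′ →
                   c (decode t) →SF c (decode t′)
                     ⊎ (c (decode t′) ≡ c (decode t) × w (apps t′) < w (apps t))
coveredInContext c w c-mono w-mono (inj₁ s)         = inj₁ (c-mono s)
coveredInContext c w c-mono w-mono (inj₂ (eq , lt)) = inj₂ (cong c eq , w-mono lt)

covered : ∀ {t t′} → t →C t′ → Covered t t′
covered (r-S0 x)         = inj₂ (refl , n<1+n _)
covered (r-S1 x y)       = inj₂ (refl , n<1+n _)
covered (r-S2 x y z)     = inj₁ (sRule _ _ _)
covered (r-F0 x)         = inj₂ (refl , n<1+n _)
covered (r-F1 x y)       = inj₂ (refl , n<1+n _)
covered (r-F2 x y z)     = inj₂ (refl , n<1+n _)
covered (r-fS0 y z)      = inj₁ (fAtom _ _ _ atomS)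
covered (r-fF0 y z)      = inj₁ (fAtom _ _ _ atomF)
covered (r-fS1 x y z)    = inj₁ (fComp _ _ _ _ (fS1 _))
covered (r-fF1 x y z)    = inj₁ (fComp _ _ _ _ (fF1 _))
covered (r-fS2 p q y z)  = inj₁ (fComp _ _ _ _ (fS2 _ _))
covered (r-fF2 p q y z)  = inj₁ (fComp _ _ _ _ (fF2 _ _))
covered (c-S₁ s)         = coveredInContext (S ·_) id (appR _) id (covered s)
covered (c-F₁ s)         = coveredInContext (F ·_) id (appR _) id (covered s)
covered (c-S₂l y s)      = coveredInContext (λ a → S · a · decode y) (_+ apps y)
                             (λ r → appL _ (appR _ r)) (+-monoˡ-< (apps y)) (covered s)
covered (c-S₂r x s)      = coveredInContext (S · decode x ·_) (apps x +_)
                             (appR _) (+-monoʳ-< (apps x)) (covered s)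
covered (c-F₂l y s)      = coveredInContext (λ a → F · a · decode y) (_+ apps y)
                             (λ r → appL _ (appR _ r)) (+-monoˡ-< (apps y)) (covered s)
covered (c-F₂r x s)      = coveredInContext (F · decode x ·_) (apps x +_)
                             (appR _) (+-monoʳ-< (apps x)) (covered s)
covered (c-appl y s)     = coveredInContext (_· decode y) (λ n → suc (n + apps y))
                             (appL _) (λ p → s≤s (+-monoˡ-< (apps y) p)) (covered s)
covered (c-appr x s)     = coveredInContext (decode x ·_) (λ n → suc (apps x + n))
                             (appR _) (λ p → s≤s (+-monoʳ-< (apps x) p)) (covered s)
covered (c-fred1 y z s)  = coveredInContext (λ a → F · a · decode y · decode z)
                             (λ n → n + apps y + apps z)
                             (λ r → appL _ (appL _ (appR _ r)))
                             (λ p → +-monoˡ-< (apps z) (+-monoˡ-< (apps y) p)) (covered s)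
covered (c-fred2 x z s)  = coveredInContext (λ a → F · decode x · a · decode z)
                             (λ n → apps x + n + apps z)
                             (λ r → appL _ (appR _ r))
                             (λ p → +-monoˡ-< (apps z) (+-monoʳ-< (apps x) p)) (covered s)
covered (c-fred3 x y s)  = coveredInContext (F · decode x · decode y ·_) (apps x + apps y +_)
                             (appR _) (+-monoʳ-< (apps x + apps y)) (covered s)

mainTheorem4 : (M : SF) → SN _→SF_ M → SN _→C_ ⟦ M ⟧ₐ
mainTheorem4 M sn = snReflect _→C_ covered ⟦ M ⟧ₐ snImage
  where
  snImage : SN _→SF_ (decode ⟦ M ⟧ₐ)
  snImage = subst (SN _→SF_) (sym (decode-⟦⟧ M)) sn
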